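{- Let $a\geq 2$ be an integer, $B=(1,a,a+1)$, and $M$ a positive integer. If $(a+1)\nmid M$ and $M\geq a\big(\lfloor \frac{M}{a+1}\rfloor+1\big)$, then $O_B(M)=1+\lfloor \frac{M}{a+1}\rfloor$; otherwise $O_B(M)=M-a\lfloor \frac{M}{a+1}\rfloor$.
   Context: For $B=(b_1,\dots,b_k)$ positive integers and an integer $M$, $O_B(M)=\min\{\sum_{i=1}^kx_i : \sum_{i=1}^k b_ix_i=M,\ x_i\in\mathbb{N}=\{0,1,2,\dots\}\}$. -}

module Defs where

open import Data.Nat using (ℕ; _+_; _*_; _≤_)
open import Data.Vec using (Vec; []; _∷_; zipWith; sum)
open import Data.Product using (Σ; _×_)
open import Relation.Binary.PropositionalEquality using (_≡_)

dot : ∀ {k} → Vec ℕ k → Vec ℕ k → ℕ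
dot b x = sum (zipWith _*_ b x)

Represents : ∀ {k} → Vec ℕ k → ℕ → Vec ℕ k → Set
Represents b M x = dot b x ≡ M

IsOB : ∀ {k} → Vec ℕ k → ℕ → ℕ → Set
IsOB {k} b M m =
  Σ (Vec ℕ k) (λ x → Represents b M x × sum x ≡ m)
  × (∀ (x : Vec ℕ k) → Represents b M x → m ≤ sum x)

module Submission where

-- Write M = q (a + 1) + r with r ≤ a, so M = (q + r) + a q. No weight exceeds a + 1, so a
-- representation uses at least M / (a + 1) coins: at least q, and at least q + 1 when r ≠ 0.
-- The representation (r, 0, q) uses q + r coins. If a ≤ q + r, trading j = a − r coins of
-- value a + 1 for j + 1 coins of value a replaces the r ones and uses q + 1 coins.
-- Otherwise q + r < a, and a representation (x, y, z) has M = (x + z) + a (y + z), so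
-- x + z ≡ q + r (mod a); as q + r is a least residue, x + z ≥ q + r.

open import Defs
open import Data.Nat using (ℕ; suc; _+_; _*_; _∸_; _≤_; _<_; _%_; z≤n; s≤s; s≤s⁻¹; NonZero)
open import Data.Nat.Properties
open import Data.Nat.Divisibility using (_∣_; _∣?_; divides; n∣m⇒m%n≡0)
open import Data.Nat.DivMod using (_/_; m≡m%n+[m/n]*n; m%n<n; m*n/n≡m; /-monoˡ-≤; m<n*o⇒m/o<n)
open import Data.Nat.Tactic.RingSolver using (solve-∀)
open import Data.Vec using (Vec; []; _∷_; sum)
open import Data.Vec.Relation.Unary.All using (All; []; _∷_)
open import Data.Product using (Σ; _×_; _,_)
open import Relation.Nullary using (¬_; yes; no; contradiction)
open import Relation.Binary.PropositionalEquality using (_≡_; refl; sym; trans; cong; subst)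

dot-≤-*-sum : ∀ {k w} (b x : Vec ℕ k) → All (_≤ w) b → dot b x ≤ w * sum x
dot-≤-*-sum []       []       []           = z≤n
dot-≤-*-sum {w = w} (b ∷ bs) (x ∷ xs) (b≤w ∷ bs≤w) = begin
  b * x + dot bs xs   ≤⟨ +-mono-≤ (*-monoˡ-≤ x b≤w) (dot-≤-*-sum bs xs bs≤w) ⟩
  w * x + w * sum xs  ≡⟨ *-distribˡ-+ w x (sum xs) ⟨
  w * (x + sum xs)    ∎
  where open ≤-Reasoning

m≤n*o⇒m/o≤n : ∀ {m n o} .{{_ : NonZero o}} → m ≤ n * o → m / o ≤ n
m≤n*o⇒m/o≤n {m} {n} {o} m≤n*o = ≤-trans (/-monoˡ-≤ o m≤n*o) (≤-reflexive (m*n/n≡m n o))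

o∤m⇒m≤n*o⇒m/o<n : ∀ {m n o} .{{_ : NonZero o}} → ¬ (o ∣ m) → m ≤ n * o → m / o < n
o∤m⇒m≤n*o⇒m/o<n {n = n} o∤m m≤n*o = m<n*o⇒m/o<n (≤∧≢⇒< m≤n*o (λ m≡n*o → o∤m (divides n m≡n*o)))

least-residue-≤ : ∀ {a c n} u v → c < a → c + a * v ≡ n + a * u → c ≤ n
least-residue-≤ {a} {c} {n} u v c<a c+av≡n+au with u ≤? v
... | yes u≤v = +-cancelʳ-≤ (a * v) c n (begin
  c + a * v  ≡⟨ c+av≡n+au ⟩
  n + a * u  ≤⟨ +-monoʳ-≤ n (*-monoʳ-≤ a u≤v) ⟩
  n + a * v  ∎)
  where open ≤-Reasoning
... | no u≰v = contradiction c+av≡n+au (<⇒≢ (begin-strict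
  c + a * v  <⟨ +-monoˡ-< (a * v) c<a ⟩
  a + a * v  ≡⟨ *-suc a v ⟨
  a * suc v  ≤⟨ *-monoʳ-≤ a (≰⇒> u≰v) ⟩
  a * u      ≤⟨ m≤n+m (a * u) n ⟩
  n + a * u  ∎))
  where open ≤-Reasoning

weights : ℕ → Vec ℕ 3
weights a = 1 ∷ a ∷ suc a ∷ []

dot-weights : ∀ a x y z → dot (weights a) (x ∷ y ∷ z ∷ []) ≡ (x + z) + a * (y + z)
dot-weights a x y z = regroup a x y z
  where
  regroup : ∀ a x y z → 1 * x + (a * y + (suc a * z + 0)) ≡ (x + z) + a * (y + z)
  regroup = solve-∀

dot-weights-≤ : ∀ a x → dot (weights a) x ≤ sum x * suc a
dot-weights-≤ a x = ≤-trans (dot-≤-*-sum (weights a) x (s≤s z≤n ∷ n≤1+n a ∷ ≤-refl ∷ []))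
                            (≤-reflexive (*-comm (suc a) (sum x)))

division-form : ∀ a M → M ≡ (M / suc a + M % suc a) + a * (M / suc a)
division-form a M = trans (m≡m%n+[m/n]*n M (suc a)) (regroup a (M % suc a) (M / suc a))
  where
  regroup : ∀ a r q → r + q * suc a ≡ (q + r) + a * q
  regroup = solve-∀

a*[q+1]≡a+a*q : ∀ a q → a * (q + 1) ≡ a + a * q
a*[q+1]≡a+a*q = solve-∀

carry-condition : ∀ {a q c M} → M ≡ c + a * q → a * (q + 1) ≤ M → a ≤ c
carry-condition {a} {q} {c} refl a[q+1]≤M =
  +-cancelʳ-≤ (a * q) a c (≤-trans (≤-reflexive (sym (a*[q+1]≡a+a*q a q))) a[q+1]≤M)

no-carry-condition : ∀ {a q c M} → M ≡ c + a * q → ¬ (a * (q + 1) ≤ M) → c < a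
no-carry-condition {a} {q} {c} refl a[q+1]≰M =
  +-cancelʳ-< (a * q) c a (<-≤-trans (≰⇒> a[q+1]≰M) (≤-reflexive (a*[q+1]≡a+a*q a q)))

residue-witness : ∀ {a q r M} → M ≡ (q + r) + a * q →
                  Σ (Vec ℕ 3) λ x → Represents (weights a) M x × sum x ≡ q + r
residue-witness {a} {q} {r} refl =
  r ∷ 0 ∷ q ∷ [] , trans (dot-weights a r 0 q) (regroup a q r) , trans (cong (r +_) (+-identityʳ q)) (+-comm r q)
  where
  regroup : ∀ a q r → (r + q) + a * (0 + q) ≡ (q + r) + a * q
  regroup = solve-∀

represents-carry : ∀ {a q r j k M} → r + j ≡ a → j + k ≡ q → M ≡ (q + r) + a * q →
                   Represents (weights a) M (0 ∷ suc j ∷ k ∷ [])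
represents-carry {r = r} {j} {k} refl refl refl = trans (dot-weights (r + j) 0 (suc j) k) (regroup r j k)
  where
  regroup : ∀ r j k → (0 + k) + (r + j) * (suc j + k) ≡ ((j + k) + r) + (r + j) * (j + k)
  regroup = solve-∀

carry-witness : ∀ {a q r M} → r ≤ a → a ≤ q + r → M ≡ (q + r) + a * q →
                Σ (Vec ℕ 3) λ x → Represents (weights a) M x × sum x ≡ 1 + q
carry-witness {a} {q} {r} r≤a a≤q+r M≡ =
  let j , r+j≡a = m≤n⇒∃[o]m+o≡n r≤a
      j≤q = +-cancelˡ-≤ r j q (begin
        r + j  ≡⟨ r+j≡a ⟩
        a      ≤⟨ a≤q+r ⟩
        q + r  ≡⟨ +-comm q r ⟩
        r + q  ∎)
      k , j+k≡q = m≤n⇒∃[o]m+o≡n j≤q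
  in 0 ∷ suc j ∷ k ∷ [] , represents-carry r+j≡a j+k≡q M≡ , cong suc (trans (cong (j +_) (+-identityʳ k)) j+k≡q)
  where open ≤-Reasoning

residue-bound : ∀ {a q r M} (x : Vec ℕ 3) → q + r < a → M ≡ (q + r) + a * q →
                Represents (weights a) M x → q + r ≤ sum x
residue-bound {a} {q} (x ∷ y ∷ z ∷ []) q+r<a M≡ rep =
  ≤-trans (least-residue-≤ (y + z) q q+r<a (trans (sym M≡) (trans (sym rep) (dot-weights a x y z))))
          (+-monoʳ-≤ x (≤-trans (m≤m+n z 0) (m≤n+m (z + 0) y)))

module _ (a M : ℕ) where
  private
    q = M / suc a
    r = M % suc a

    M≡ : M ≡ (q + r) + a * q
    M≡ = division-form a M

    M≤sum*[a+1] : ∀ x → Represents (weights a) M x → M ≤ sum x * suc a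
    M≤sum*[a+1] x rep = ≤-trans (≤-reflexive (sym rep)) (dot-weights-≤ a x)

  isOB-carry : ¬ (suc a ∣ M) → a * (q + 1) ≤ M → IsOB (weights a) M (1 + q)
  isOB-carry a+1∤M a[q+1]≤M =
    carry-witness (s≤s⁻¹ (m%n<n M (suc a))) (carry-condition M≡ a[q+1]≤M) M≡ ,
    λ x rep → o∤m⇒m≤n*o⇒m/o<n a+1∤M (M≤sum*[a+1] x rep)

  isOB-residue : ¬ (¬ (suc a ∣ M) × a * (q + 1) ≤ M) → IsOB (weights a) M (q + r)
  isOB-residue ¬carry = residue-witness M≡ , lower
    where
    lower : ∀ x → Represents (weights a) M x → q + r ≤ sum x
    lower x rep with suc a ∣? M
    ... | yes a+1∣M = begin
      q + r  ≡⟨ cong (q +_) (n∣m⇒m%n≡0 M (suc a) a+1∣M) ⟩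
      q + 0  ≡⟨ +-identityʳ q ⟩
      q      ≤⟨ m≤n*o⇒m/o≤n (M≤sum*[a+1] x rep) ⟩
      sum x  ∎
      where open ≤-Reasoning
    ... | no a+1∤M = residue-bound x (no-carry-condition M≡ (λ le → ¬carry (a+1∤M , le))) M≡ rep

lemma3p9 : (a M : ℕ) → 2 ≤ a → 1 ≤ M →
    ((¬ (suc a ∣ M) × a * (M / suc a + 1) ≤ M) →
    IsOB (1 ∷ a ∷ suc a ∷ []) M (1 + M / suc a))
    × (¬ (¬ (suc a ∣ M) × a * (M / suc a + 1) ≤ M) →
    IsOB (1 ∷ a ∷ suc a ∷ []) M (M ∸ a * (M / suc a)))
lemma3p9 a M _ _ =
  (λ (a+1∤M , a[q+1]≤M) → isOB-carry a M a+1∤M a[q+1]≤M) ,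
  (λ ¬carry → subst (IsOB (weights a) M) (sym M∸a*q≡q+r) (isOB-residue a M ¬carry))
  where
  q = M / suc a
  M∸a*q≡q+r : M ∸ a * q ≡ q + M % suc a
  M∸a*q≡q+r = trans (cong (_∸ a * q) (division-form a M)) (m+n∸n≡m (q + M % suc a) (a * q))
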